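{- Let $P=(X,\prec)$ be a poset on $n=|X|$ elements and $x\in\min(P)$. Then there exist a poset $Q=(Y,\prec')$ with $|Y|=n+1$ and $y\in\min(Q)$ such that $\rho(Q,y)=1+\dfrac{1}{\rho(P,x)}$.
   Context: For a finite poset $P$, $e(P)$ is its number of linear extensions; for a minimal element $x$ of $P$, $\rho(P,x):=e(P)/e(P-x)$, where $P-x$ is the subposet on $X\setminus\{x\}$. -}

module Defs where

open import Data.Nat using (ℕ; zero; suc)
open import Data.Bool using (Bool; true; false; T; _∧_; not)
open import Data.Fin using (Fin; punchIn)
open import Data.List using (List; []; _∷_; map; concatMap; filter; length; allFin)
open import Relation.Binary.PropositionalEquality using (_≡_)
open import Relation.Nullary.Decidable using (Dec; yes; no)
open import Data.Bool.Properties using (T?)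
open import Relation.Nullary using (¬_)

record Poset (n : ℕ) : Set where
  field
    _≺_    : Fin n → Fin n → Bool
    irrefl : ∀ a → ¬ T (a ≺ a)
    trans  : ∀ a b c → T (a ≺ b) → T (b ≺ c) → T (a ≺ c)
open Poset public

IsMin : ∀ {n} → Poset n → Fin n → Set
IsMin P x = ∀ a → _≺_ P a x ≡ false

-- P - x : the induced subposet on the remaining elements, relabelled
-- by Fin n via punchIn x.
remove : ∀ {n} → (P : Poset (suc n)) → Fin (suc n) → Poset n
remove P x = record
  { _≺_    = λ a b → _≺_ P (punchIn x a) (punchIn x b)
  ; irrefl = λ a → irrefl P (punchIn x a)
  ; trans  = λ a b c → trans P (punchIn x a) (punchIn x b) (punchIn x c)
  }

insertAll : ∀ {A : Set} → A → List A → List (List A)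
insertAll a []       = (a ∷ []) ∷ []
insertAll a (b ∷ bs) = (a ∷ b ∷ bs) ∷ map (b ∷_) (insertAll a bs)

perms : ∀ {A : Set} → List A → List (List A)
perms []       = [] ∷ []
perms (a ∷ as) = concatMap (insertAll a) (perms as)

allB : ∀ {A : Set} → (A → Bool) → List A → Bool
allB p []       = true
allB p (a ∷ as) = p a ∧ allB p as

compatible : ∀ {n} → Poset n → List (Fin n) → Bool
compatible P []       = true
compatible P (a ∷ as) = allB (λ b → not (_≺_ P b a)) as ∧ compatible P as

-- e(P): the number of linear extensions of P, i.e. the number of orderings
-- of the ground set Fin n compatible with P
e : ∀ {n} → Poset n → ℕ
e {n} P = length (filter (λ l → T? (compatible P l)) (perms (allFin n)))

-- Adjoin to P a new element y lying below every element of P except x.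
-- Then y is minimal and Q - y = P.  In a linear extension of Q, y either
-- comes first, followed by a linear extension of P, or comes second, right
-- after x, followed by a linear extension of P - x (every other element
-- lies above y).  Hence e(Q) = e(P) + e(P - x).
module Submission where

open import Defs
open import Data.Bool using (Bool; true; false; T; not; _∧_; if_then_else_)
open import Data.Bool.Properties using (T?; ∧-zeroʳ)
open import Data.Empty using (⊥; ⊥-elim)
open import Data.Fin using (Fin; zero; suc; punchIn; _≟_)
open import Data.Fin.Properties using (punchInᵢ≢i)
open import Data.List using (List; []; _∷_; map; concatMap; filter; length; allFin; _++_)
open import Data.List.Membership.Propositional using (_∈_; _∉_)
open import Data.List.Membership.Propositional.Properties using (∈-map⁻)
open import Data.List.Properties using (map-∘; map-++; map-tabulate; concatMap-map; concatMap-cong; map-concatMap)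
open import Data.List.Relation.Unary.Any using (here; there)
open import Data.Nat using (ℕ; suc; _+_; _*_)
open import Data.Nat.Properties using (+-assoc; +-identityʳ; *-comm)
open import Data.Nat.Tactic.RingSolver using (solve-∀)
open import Data.Product using (Σ; _×_; _,_; ∃₂)
open import Data.Unit using (tt)
open import Function using (_∘_; id)
open import Relation.Binary.Definitions using (DecidableEquality)
open import Relation.Binary.PropositionalEquality using (_≡_; _≢_; refl; sym; cong; cong₂; subst; module ≡-Reasoning)
  renaming (trans to ≡-trans)
open import Relation.Nullary.Decidable using (does; yes; no; dec-true; dec-false)

private variable
  A B : Set

sumBy : (A → ℕ) → List A → ℕ
sumBy f []       = 0
sumBy f (a ∷ as) = f a + sumBy f as

sumBy-++ : ∀ (f : A → ℕ) l m → sumBy f (l ++ m) ≡ sumBy f l + sumBy f m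
sumBy-++ f []      m = refl
sumBy-++ f (a ∷ l) m = ≡-trans (cong (f a +_) (sumBy-++ f l m)) (sym (+-assoc (f a) _ _))

sumBy-map : ∀ (f : B → ℕ) (g : A → B) l → sumBy f (map g l) ≡ sumBy (f ∘ g) l
sumBy-map f g []      = refl
sumBy-map f g (a ∷ l) = cong (f (g a) +_) (sumBy-map f g l)

sumBy-concatMap : ∀ (f : B → ℕ) (g : A → List B) l →
  sumBy f (concatMap g l) ≡ sumBy (sumBy f ∘ g) l
sumBy-concatMap f g []      = refl
sumBy-concatMap f g (a ∷ l) =
  ≡-trans (sumBy-++ f (g a) (concatMap g l)) (cong (sumBy f (g a) +_) (sumBy-concatMap f g l))

sumBy-cong : ∀ {f g : A → ℕ} → (∀ a → f a ≡ g a) → ∀ l → sumBy f l ≡ sumBy g l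
sumBy-cong f≗g []      = refl
sumBy-cong f≗g (a ∷ l) = cong₂ _+_ (f≗g a) (sumBy-cong f≗g l)

sumBy-+ : ∀ (f g : A → ℕ) l → sumBy (λ a → f a + g a) l ≡ sumBy f l + sumBy g l
sumBy-+ f g []      = refl
sumBy-+ f g (a ∷ l) = ≡-trans (cong (f a + g a +_) (sumBy-+ f g l)) (shuffle (f a) (g a) _ _)
  where
  shuffle : ∀ p q r s → p + q + (r + s) ≡ p + r + (q + s)
  shuffle = solve-∀

sumBy-vanishes : ∀ (f : A → ℕ) l → (∀ {a} → a ∈ l → f a ≡ 0) → sumBy f l ≡ 0
sumBy-vanishes f []      f≡0 = refl
sumBy-vanishes f (a ∷ l) f≡0 = cong₂ _+_ (f≡0 (here refl)) (sumBy-vanishes f l (f≡0 ∘ there))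

sumBy-if : ∀ b (f : A → ℕ) l → sumBy (λ a → if b then f a else 0) l ≡ (if b then sumBy f l else 0)
sumBy-if true  f l = refl
sumBy-if false f l = sumBy-vanishes _ l λ _ → refl

indicator : Bool → ℕ
indicator true  = 1
indicator false = 0

length-filter : ∀ (b : A → Bool) l →
  length (filter (λ a → T? (b a)) l) ≡ sumBy (indicator ∘ b) l
length-filter b []      = refl
length-filter b (a ∷ l) with b a
... | true  = cong suc (length-filter b l)
... | false = length-filter b l

e-as-sum : ∀ {n} (P : Poset n) → e P ≡ sumBy (indicator ∘ compatible P) (perms (allFin n))
e-as-sum {n} P = length-filter (compatible P) (perms (allFin n))

insertAll-map : ∀ (g : A → B) a τ → insertAll (g a) (map g τ) ≡ map (map g) (insertAll a τ)
insertAll-map g a []      = refl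
insertAll-map g a (c ∷ τ) = cong ((g a ∷ g c ∷ map g τ) ∷_) (begin
    map (g c ∷_) (insertAll (g a) (map g τ))   ≡⟨ cong (map (g c ∷_)) (insertAll-map g a τ) ⟩
    map (g c ∷_) (map (map g) (insertAll a τ)) ≡⟨ sym (map-∘ (insertAll a τ)) ⟩
    map (map g ∘ (c ∷_)) (insertAll a τ)       ≡⟨ map-∘ (insertAll a τ) ⟩
    map (map g) (map (c ∷_) (insertAll a τ))   ∎)
  where open ≡-Reasoning

perms-map : ∀ (g : A → B) l → perms (map g l) ≡ map (map g) (perms l)
perms-map g []      = refl
perms-map g (a ∷ l) = begin
  concatMap (insertAll (g a)) (perms (map g l))       ≡⟨ cong (concatMap _) (perms-map g l) ⟩
  concatMap (insertAll (g a)) (map (map g) (perms l)) ≡⟨ concatMap-map _ (map g) (perms l) ⟩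
  concatMap (insertAll (g a) ∘ map g) (perms l)       ≡⟨ concatMap-cong (insertAll-map g a) (perms l) ⟩
  concatMap (map (map g) ∘ insertAll a) (perms l)     ≡⟨ sym (map-concatMap (map g) (insertAll a) (perms l)) ⟩
  map (map g) (concatMap (insertAll a) (perms l))     ∎
  where open ≡-Reasoning

sumBy-perms-map : ∀ (f : List B → ℕ) (g : A → B) l →
  sumBy f (perms (map g l)) ≡ sumBy (f ∘ map g) (perms l)
sumBy-perms-map f g l = ≡-trans (cong (sumBy f) (perms-map g l)) (sumBy-map f (map g) (perms l))

module StartingWith (_≟ᴬ_ : DecidableEquality A) (x : A) where

  startingWith : (List A → ℕ) → List A → ℕ
  startingWith G []      = 0
  startingWith G (h ∷ σ) = if does (h ≟ᴬ x) then G σ else 0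

  startingWith-self : ∀ G σ → startingWith G (x ∷ σ) ≡ G σ
  startingWith-self G σ rewrite dec-true (x ≟ᴬ x) refl = refl

  startingWith-≢ : ∀ G {a} σ → a ≢ x → startingWith G (a ∷ σ) ≡ 0
  startingWith-≢ G {a} σ a≢x rewrite dec-false (a ≟ᴬ x) a≢x = refl

  sumBy-startingWith-insertAll : ∀ G a ρ →
    sumBy (startingWith G) (insertAll a ρ) ≡ startingWith G (a ∷ ρ) + startingWith (sumBy G ∘ insertAll a) ρ
  sumBy-startingWith-insertAll G a []      = refl
  sumBy-startingWith-insertAll G a (h ∷ τ) = cong (startingWith G (a ∷ h ∷ τ) +_)
    (≡-trans (sumBy-map (startingWith G) (h ∷_) (insertAll a τ)) (sumBy-if (does (h ≟ᴬ x)) G (insertAll a τ)))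

  sumBy-startingWith-insertAll-self : ∀ G ρ →
    sumBy (startingWith G) (insertAll x ρ) ≡ G ρ + startingWith (sumBy G ∘ insertAll x) ρ
  sumBy-startingWith-insertAll-self G ρ =
    ≡-trans (sumBy-startingWith-insertAll G x ρ)
            (cong (_+ startingWith (sumBy G ∘ insertAll x) ρ) (startingWith-self G ρ))

  sumBy-startingWith-insertAll-≢ : ∀ G {a} ρ → a ≢ x →
    sumBy (startingWith G) (insertAll a ρ) ≡ startingWith (sumBy G ∘ insertAll a) ρ
  sumBy-startingWith-insertAll-≢ G {a} ρ a≢x =
    ≡-trans (sumBy-startingWith-insertAll G a ρ)
            (cong (_+ startingWith (sumBy G ∘ insertAll a) ρ) (startingWith-≢ G ρ a≢x))

  sumBy-perms-startingWith-∉ : ∀ G l → x ∉ l → sumBy (startingWith G) (perms l) ≡ 0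
  sumBy-perms-startingWith-∉ G []      x∉l = refl
  sumBy-perms-startingWith-∉ G (a ∷ l) x∉l = begin
    sumBy (startingWith G) (concatMap (insertAll a) (perms l))
      ≡⟨ sumBy-concatMap (startingWith G) (insertAll a) (perms l) ⟩
    sumBy (sumBy (startingWith G) ∘ insertAll a) (perms l)
      ≡⟨ sumBy-cong (λ ρ → sumBy-startingWith-insertAll-≢ G ρ λ a≡x → x∉l (here (sym a≡x))) (perms l) ⟩
    sumBy (startingWith (sumBy G ∘ insertAll a)) (perms l)
      ≡⟨ sumBy-perms-startingWith-∉ (sumBy G ∘ insertAll a) l (x∉l ∘ there) ⟩
    0 ∎
    where open ≡-Reasoning

  -- As x occurs only once, the orderings starting with x are exactly x
  -- followed by an ordering of the other elements.
  sumBy-perms-startingWith : ∀ G u v → x ∉ u ++ v →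
    sumBy (startingWith G) (perms (u ++ x ∷ v)) ≡ sumBy G (perms (u ++ v))
  sumBy-perms-startingWith G [] v x∉v = begin
    sumBy (startingWith G) (concatMap (insertAll x) (perms v))
      ≡⟨ sumBy-concatMap (startingWith G) (insertAll x) (perms v) ⟩
    sumBy (sumBy (startingWith G) ∘ insertAll x) (perms v)
      ≡⟨ sumBy-cong (sumBy-startingWith-insertAll-self G) (perms v) ⟩
    sumBy (λ ρ → G ρ + startingWith (sumBy G ∘ insertAll x) ρ) (perms v)
      ≡⟨ sumBy-+ G (startingWith (sumBy G ∘ insertAll x)) (perms v) ⟩
    sumBy G (perms v) + sumBy (startingWith (sumBy G ∘ insertAll x)) (perms v)
      ≡⟨ cong (sumBy G (perms v) +_) (sumBy-perms-startingWith-∉ (sumBy G ∘ insertAll x) v x∉v) ⟩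
    sumBy G (perms v) + 0
      ≡⟨ +-identityʳ _ ⟩
    sumBy G (perms v) ∎
    where open ≡-Reasoning
  sumBy-perms-startingWith G (a ∷ u) v x∉au++v = begin
    sumBy (startingWith G) (concatMap (insertAll a) (perms (u ++ x ∷ v)))
      ≡⟨ sumBy-concatMap (startingWith G) (insertAll a) (perms (u ++ x ∷ v)) ⟩
    sumBy (sumBy (startingWith G) ∘ insertAll a) (perms (u ++ x ∷ v))
      ≡⟨ sumBy-cong (λ ρ → sumBy-startingWith-insertAll-≢ G ρ λ a≡x → x∉au++v (here (sym a≡x)))
                    (perms (u ++ x ∷ v)) ⟩
    sumBy (startingWith (sumBy G ∘ insertAll a)) (perms (u ++ x ∷ v))
      ≡⟨ sumBy-perms-startingWith (sumBy G ∘ insertAll a) u v (x∉au++v ∘ there) ⟩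
    sumBy (sumBy G ∘ insertAll a) (perms (u ++ v))
      ≡⟨ sym (sumBy-concatMap G (insertAll a) (perms (u ++ v))) ⟩
    sumBy G (perms (a ∷ u ++ v)) ∎
    where open ≡-Reasoning

allFin-suc : ∀ n → allFin (suc n) ≡ zero ∷ map suc (allFin n)
allFin-suc n = cong (zero ∷_) (sym (map-tabulate id suc))

allFin-split : ∀ {n} (x : Fin (suc n)) →
  ∃₂ λ u v → allFin (suc n) ≡ u ++ x ∷ v × u ++ v ≡ map (punchIn x) (allFin n)
allFin-split {n} zero = [] , map suc (allFin n) , allFin-suc n , refl
allFin-split {suc m} (suc x) with allFin-split x
... | u , v , split , rest = zero ∷ map suc u , map suc v , split′ , rest′
  where
  open ≡-Reasoning
  split′ : allFin (suc (suc m)) ≡ zero ∷ map suc u ++ suc x ∷ map suc v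
  split′ = begin
    allFin (suc (suc m))             ≡⟨ allFin-suc (suc m) ⟩
    zero ∷ map suc (allFin (suc m))  ≡⟨ cong (λ l → zero ∷ map suc l) split ⟩
    zero ∷ map suc (u ++ x ∷ v)      ≡⟨ cong (zero ∷_) (map-++ suc u (x ∷ v)) ⟩
    zero ∷ map suc u ++ suc x ∷ map suc v ∎
  rest′ : zero ∷ map suc u ++ map suc v ≡ map (punchIn (suc x)) (allFin (suc m))
  rest′ = begin
    zero ∷ map suc u ++ map suc v                     ≡⟨ cong (zero ∷_) (sym (map-++ suc u v)) ⟩
    zero ∷ map suc (u ++ v)                           ≡⟨ cong (λ l → zero ∷ map suc l) rest ⟩
    zero ∷ map suc (map (punchIn x) (allFin m))       ≡⟨ cong (zero ∷_) (sym (map-∘ (allFin m))) ⟩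
    zero ∷ map (punchIn (suc x) ∘ suc) (allFin m)     ≡⟨ cong (zero ∷_) (map-∘ (allFin m)) ⟩
    zero ∷ map (punchIn (suc x)) (map suc (allFin m)) ≡⟨ cong (map (punchIn (suc x))) (sym (allFin-suc m)) ⟩
    map (punchIn (suc x)) (allFin (suc m))            ∎

∉-map-punchIn : ∀ {n} (x : Fin (suc n)) l → x ∉ map (punchIn x) l
∉-map-punchIn x l x∈ with ∈-map⁻ (punchIn x) x∈
... | a , _ , x≡ = punchInᵢ≢i x a (sym x≡)

module _ (p : A → Bool) where

  allB-map : ∀ {q : B → Bool} (g : B → A) → (∀ b → p (g b) ≡ q b) → ∀ l →
    allB p (map g l) ≡ allB q l
  allB-map g pg≗q []      = refl
  allB-map g pg≗q (b ∷ l) = cong₂ _∧_ (pg≗q b) (allB-map g pg≗q l)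

  allB-true : (∀ a → p a ≡ true) → ∀ l → allB p l ≡ true
  allB-true p≡true []      = refl
  allB-true p≡true (a ∷ l) rewrite p≡true a = allB-true p≡true l

  allB-false : ∀ {a l} → a ∈ l → p a ≡ false → allB p l ≡ false
  allB-false (here refl) pa≡false rewrite pa≡false = refl
  allB-false {l = b ∷ l} (there a∈l) pa≡false =
    ≡-trans (cong (p b ∧_) (allB-false a∈l pa≡false)) (∧-zeroʳ (p b))

compatible-map : ∀ {m n} (R : Poset m) (P : Poset n) (g : Fin m → Fin n) →
  (∀ a b → _≺_ P (g a) (g b) ≡ _≺_ R a b) → ∀ l → compatible P (map g l) ≡ compatible R l
compatible-map R P g g-mono []      = refl
compatible-map R P g g-mono (a ∷ l) =
  cong₂ _∧_ (allB-map _ g (λ b → cong not (g-mono b a)) l) (compatible-map R P g g-mono l)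

compatible-min-∷ : ∀ {n} (P : Poset n) {a} → IsMin P a → ∀ l → compatible P (a ∷ l) ≡ compatible P l
compatible-min-∷ P a-min l = cong (_∧ compatible P l) (allB-true _ (λ b → cong not (a-min b)) l)

compatible-below-∷ : ∀ {n} (P : Poset n) {a b l} → b ∈ l → _≺_ P b a ≡ true → compatible P (a ∷ l) ≡ false
compatible-below-∷ P b∈l b≺a = cong (_∧ _) (allB-false _ b∈l (cong not b≺a))

∈-insertAll : ∀ {a : A} {σ} l → σ ∈ insertAll a l → a ∈ σ
∈-insertAll []      (here refl) = here refl
∈-insertAll (b ∷ l) (here refl) = here refl
∈-insertAll (b ∷ l) (there σ∈) with ∈-map⁻ (b ∷_) σ∈
... | _ , σ′∈ , refl = there (∈-insertAll l σ′∈)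

module AdjoinBelow {n : ℕ} (P : Poset (suc n)) (x : Fin (suc n)) (x-min : IsMin P x) where

  open StartingWith _≟_ x

  -- The new element y is zero; P is embedded by suc.
  _≺ʸ_ : Fin (suc (suc n)) → Fin (suc (suc n)) → Bool
  zero  ≺ʸ zero  = false
  zero  ≺ʸ suc b = not (does (b ≟ x))
  suc a ≺ʸ zero  = false
  suc a ≺ʸ suc b = _≺_ P a b

  ≺ʸ-irrefl : ∀ a → T (a ≺ʸ a) → ⊥
  ≺ʸ-irrefl zero    ()
  ≺ʸ-irrefl (suc a) = irrefl P a

  ≺ʸ-trans : ∀ a b c → T (a ≺ʸ b) → T (b ≺ʸ c) → T (a ≺ʸ c)
  ≺ʸ-trans zero    zero    c       ()
  ≺ʸ-trans zero    (suc b) zero    _  ()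
  ≺ʸ-trans zero    (suc b) (suc c) _  b≺c with c ≟ x
  ... | yes refl rewrite x-min b = ⊥-elim b≺c
  ... | no  _    = tt
  ≺ʸ-trans (suc a) zero    c       ()
  ≺ʸ-trans (suc a) (suc b) zero    _  ()
  ≺ʸ-trans (suc a) (suc b) (suc c) a≺b b≺c = Poset.trans P a b c a≺b b≺c

  Q : Poset (suc (suc n))
  Q = record { _≺_ = _≺ʸ_ ; irrefl = ≺ʸ-irrefl ; trans = ≺ʸ-trans }

  y-min : IsMin Q zero
  y-min zero    = refl
  y-min (suc a) = refl

  suc-x-min : IsMin Q (suc x)
  suc-x-min zero    = cong not (dec-true (x ≟ x) refl)
  suc-x-min (suc a) = x-min a

  countQ : List (Fin (suc (suc n))) → ℕ
  countQ = indicator ∘ compatible Q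

  insertions : List (Fin (suc n)) → ℕ
  insertions σ = sumBy countQ (insertAll zero (map suc σ))

  insertions-after : ∀ h τ →
    sumBy (countQ ∘ (suc h ∷_)) (insertAll zero (map suc τ))
      ≡ startingWith insertions (h ∷ τ)
  insertions-after h τ with h ≟ x
  ... | yes refl = sumBy-cong (λ ρ → cong indicator (compatible-min-∷ Q suc-x-min ρ)) (insertAll zero (map suc τ))
  ... | no h≢x  = sumBy-vanishes _ (insertAll zero (map suc τ)) λ ρ∈ →
    cong indicator (compatible-below-∷ Q (∈-insertAll (map suc τ) ρ∈) (cong not (dec-false (h ≟ x) h≢x)))

  insertions-∷ : ∀ σ → insertions σ ≡ indicator (compatible P σ) + startingWith insertions σ
  insertions-∷ []      = refl
  insertions-∷ (h ∷ τ) = cong₂ _+_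
    (cong indicator (≡-trans (compatible-min-∷ Q y-min (map suc (h ∷ τ)))
                             (compatible-map P Q suc (λ _ _ → refl) (h ∷ τ))))
    (≡-trans (sumBy-map countQ (suc h ∷_) (insertAll zero (map suc τ))) (insertions-after h τ))

  insertions-punchIn : ∀ τ → insertions (map (punchIn x) τ) ≡ indicator (compatible (remove P x) τ)
  insertions-punchIn τ = begin
    insertions (map (punchIn x) τ)
      ≡⟨ insertions-∷ (map (punchIn x) τ) ⟩
    indicator (compatible P (map (punchIn x) τ)) + startingWith insertions (map (punchIn x) τ)
      ≡⟨ cong₂ _+_ (cong indicator (compatible-map (remove P x) P (punchIn x) (λ _ _ → refl) τ))
                   (never-x τ) ⟩
    indicator (compatible (remove P x) τ) + 0
      ≡⟨ +-identityʳ _ ⟩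
    indicator (compatible (remove P x) τ) ∎
    where
    open ≡-Reasoning
    never-x : ∀ τ → startingWith insertions (map (punchIn x) τ) ≡ 0
    never-x []      = refl
    never-x (a ∷ τ) = startingWith-≢ insertions (map (punchIn x) τ) (punchInᵢ≢i x a)

  e-Q-insertions : e Q ≡ sumBy insertions (perms (allFin (suc n)))
  e-Q-insertions = begin
    e Q
      ≡⟨ e-as-sum Q ⟩
    sumBy countQ (perms (allFin (suc (suc n))))
      ≡⟨ cong (sumBy countQ ∘ perms) (allFin-suc (suc n)) ⟩
    sumBy countQ (concatMap (insertAll zero) (perms (map suc (allFin (suc n)))))
      ≡⟨ sumBy-concatMap countQ (insertAll zero) (perms (map suc (allFin (suc n)))) ⟩
    sumBy (sumBy countQ ∘ insertAll zero) (perms (map suc (allFin (suc n))))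
      ≡⟨ sumBy-perms-map (sumBy countQ ∘ insertAll zero) suc (allFin (suc n)) ⟩
    sumBy insertions (perms (allFin (suc n))) ∎
    where open ≡-Reasoning

  sumBy-perms-startingWith-x : sumBy (startingWith insertions) (perms (allFin (suc n))) ≡ e (remove P x)
  sumBy-perms-startingWith-x with allFin-split x
  ... | u , v , split , rest = begin
    sumBy (startingWith insertions) (perms (allFin (suc n)))
      ≡⟨ cong (sumBy (startingWith insertions) ∘ perms) split ⟩
    sumBy (startingWith insertions) (perms (u ++ x ∷ v))
      ≡⟨ sumBy-perms-startingWith insertions u v (∉-map-punchIn x (allFin n) ∘ subst (x ∈_) rest) ⟩
    sumBy insertions (perms (u ++ v))
      ≡⟨ cong (sumBy insertions ∘ perms) rest ⟩
    sumBy insertions (perms (map (punchIn x) (allFin n)))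
      ≡⟨ sumBy-perms-map insertions (punchIn x) (allFin n) ⟩
    sumBy (insertions ∘ map (punchIn x)) (perms (allFin n))
      ≡⟨ sumBy-cong insertions-punchIn (perms (allFin n)) ⟩
    sumBy (indicator ∘ compatible (remove P x)) (perms (allFin n))
      ≡⟨ sym (e-as-sum (remove P x)) ⟩
    e (remove P x) ∎
    where open ≡-Reasoning

  e-Q : e Q ≡ e P + e (remove P x)
  e-Q = begin
    e Q
      ≡⟨ e-Q-insertions ⟩
    sumBy insertions (perms (allFin (suc n)))
      ≡⟨ sumBy-cong insertions-∷ (perms (allFin (suc n))) ⟩
    sumBy (λ σ → indicator (compatible P σ) + startingWith insertions σ) (perms (allFin (suc n)))
      ≡⟨ sumBy-+ (indicator ∘ compatible P) (startingWith insertions) (perms (allFin (suc n))) ⟩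
    sumBy (indicator ∘ compatible P) (perms (allFin (suc n))) + sumBy (startingWith insertions) (perms (allFin (suc n)))
      ≡⟨ cong₂ _+_ (sym (e-as-sum P)) sumBy-perms-startingWith-x ⟩
    e P + e (remove P x) ∎
    where open ≡-Reasoning

lemma7p4 : (n : ℕ) (P : Poset (suc n)) (x : Fin (suc n)) → IsMin P x →
    Σ (Poset (suc (suc n))) λ Q → Σ (Fin (suc (suc n))) λ y →
      IsMin Q y × (e Q * e P ≡ e (remove Q y) * (e P + e (remove P x)))
lemma7p4 n P x x-min = Q , zero , y-min , ≡-trans (cong (_* e P) e-Q) (*-comm (e P + e (remove P x)) (e P))
  where open AdjoinBelow P x x-min
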